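{- (Weak disjunction property.) For all formulas $A,B$: if $\mathsf{IEL}^{ - }\vdash\Box(A\vee B)$, then $\mathsf{IEL}^{ - }\vdash\Box A$ or $\mathsf{IEL}^{ - }\vdash\Box B$.
   Context: Formulas: built from propositional atoms and $\bot$ by $\wedge,\vee,\rightarrow$ and a unary modality $\Box$. $\mathsf{IEL}^{ - }$ is the natural deduction system with the usual intuitionistic (NJ) introduction/elimination rules for $\wedge,\vee,\rightarrow$, ex falso ($\bot$-elimination), and the $\Box$-intro rule: from deductions of $\Box A_1,\dots,\Box A_n$ (from assumptions $\Gamma_1,\dots,\Gamma_n$) and a deduction of $B$ from assumptions $A_1,\dots,A_n,\Delta$, infer $\Box B$, discharging $A_1,\dots,A_n$ ($n\ge0$). $\mathsf{IEL}^{ - }\vdash A$ means $A$ has a deduction with no undischarged assumptions. -}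

module Defs where

open import Data.Nat using (ℕ)
open import Data.List using (List; []; _∷_; _++_)
open import Data.List.Membership.Propositional using (_∈_)

data Formula : Set where
  atom : ℕ → Formula
  ⊥'   : Formula
  _∧'_ : Formula → Formula → Formula
  _∨'_ : Formula → Formula → Formula
  _⇒_  : Formula → Formula → Formula
  □_   : Formula → Formula

infixr 6 _∧'_
infixr 5 _∨'_
infixr 4 _⇒_
infix  7 □_

Context : Set
Context = List Formula

-- Natural deduction for IEL⁻ in sequent (context) presentation:
-- Γ ⊢ A means: A has a deduction whose undischarged assumptions are among Γ.
mutual
  infix 2 _⊢_
  data _⊢_ (Γ : Context) : Formula → Set where
    ax   : ∀ {A} → A ∈ Γ → Γ ⊢ A
    ∧I   : ∀ {A B} → Γ ⊢ A → Γ ⊢ B → Γ ⊢ A ∧' B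
    ∧E₁  : ∀ {A B} → Γ ⊢ A ∧' B → Γ ⊢ A
    ∧E₂  : ∀ {A B} → Γ ⊢ A ∧' B → Γ ⊢ B
    ∨I₁  : ∀ {A B} → Γ ⊢ A → Γ ⊢ A ∨' B
    ∨I₂  : ∀ {A B} → Γ ⊢ B → Γ ⊢ A ∨' B
    ∨E   : ∀ {A B C} → Γ ⊢ A ∨' B → (A ∷ Γ) ⊢ C → (B ∷ Γ) ⊢ C → Γ ⊢ C
    ⇒I   : ∀ {A B} → (A ∷ Γ) ⊢ B → Γ ⊢ A ⇒ B
    ⇒E   : ∀ {A B} → Γ ⊢ A ⇒ B → Γ ⊢ A → Γ ⊢ B
    ⊥E   : ∀ {A} → Γ ⊢ ⊥' → Γ ⊢ A
    -- □-intro: from deductions of □A₁,…,□Aₙ and a deduction of B from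
    -- A₁,…,Aₙ,Δ (Δ ⊆ Γ the remaining open assumptions), infer □B,
    -- discharging A₁,…,Aₙ (n ≥ 0).
    □I   : ∀ {B} (As : List Formula) → Boxes Γ As → (As ++ Γ) ⊢ B → Γ ⊢ □ B

  data Boxes (Γ : Context) : List Formula → Set where
    []  : Boxes Γ []
    _∷_ : ∀ {A As} → Γ ⊢ □ A → Boxes Γ As → Boxes Γ (A ∷ As)

IEL⁻⊢ : Formula → Set
IEL⁻⊢ A = [] ⊢ A

-- A gluing (Aczel-slash style) argument. Define k ⊩ A by recursion on A so
-- that it implies provability of □ᵏA, with k ⊩ A ∨ B a genuine disjunction and
-- k ⊩ □A requiring (k+1) ⊩ A. Every deduction is sound for ⊩, so a proof of
-- □(A ∨ B) forces 1 ⊩ A or 1 ⊩ B, which yields a proof of □A or of □B.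
module Submission where

open import Defs
open import Data.Empty using (⊥; ⊥-elim)
open import Data.List using ([]; _∷_)
open import Data.List.Relation.Unary.All as All using (All; []; _∷_)
open import Data.List.Relation.Unary.All.Properties using (++⁺)
open import Data.List.Relation.Unary.Any using (here; there)
open import Data.Nat using (ℕ; zero; suc; _≤_; z≤n; s≤s; _≤′_; ≤′-refl; ≤′-step)
open import Data.Nat.Properties using (≤-refl; ≤-trans; n≤1+n; ≤⇒≤′)
open import Data.Product using (_×_; _,_; proj₁; proj₂)
open import Data.Sum as Sum using (_⊎_; inj₁; inj₂; [_,_])
open import Relation.Binary.PropositionalEquality using (refl)

□ⁿ : ℕ → Formula → Formula
□ⁿ zero    A = A
□ⁿ (suc k) A = □ □ⁿ k A

□-coreflect : ∀ {Γ A} → Γ ⊢ A → Γ ⊢ □ A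
□-coreflect d = □I [] [] d

□ⁿ-coreflect-≤′ : ∀ {Γ k j A} → k ≤′ j → Γ ⊢ □ⁿ k A → Γ ⊢ □ⁿ j A
□ⁿ-coreflect-≤′ ≤′-refl      d = d
□ⁿ-coreflect-≤′ (≤′-step k≤j) d = □-coreflect (□ⁿ-coreflect-≤′ k≤j d)

□ⁿ-⇒E : ∀ k {Γ A B} → Γ ⊢ □ⁿ k (A ⇒ B) → Γ ⊢ □ⁿ k A → Γ ⊢ □ⁿ k B
□ⁿ-⇒E zero    d e = ⇒E d e
□ⁿ-⇒E (suc k) d e = □I (_ ∷ _ ∷ []) (d ∷ e ∷ [])
  (□ⁿ-⇒E k (ax (here refl)) (ax (there (here refl))))

infixr 4 _⇒*_

_⇒*_ : Context → Formula → Formula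
[]      ⇒* C = C
(A ∷ Γ) ⇒* C = Γ ⇒* (A ⇒ C)

⇒I* : ∀ {Γ C} → Γ ⊢ C → [] ⊢ Γ ⇒* C
⇒I* {[]}    d = d
⇒I* {A ∷ Γ} d = ⇒I* (⇒I d)

□ⁿ-⇒E* : ∀ k {Δ Γ C} → Δ ⊢ □ⁿ k (Γ ⇒* C) → All (λ A → Δ ⊢ □ⁿ k A) Γ → Δ ⊢ □ⁿ k C
□ⁿ-⇒E* k d []       = d
□ⁿ-⇒E* k d (e ∷ es) = □ⁿ-⇒E k (□ⁿ-⇒E* k d es) e

□ⁿ-closed : ∀ k {Γ C} → Γ ⊢ C → All (λ A → [] ⊢ □ⁿ k A) Γ → [] ⊢ □ⁿ k C
□ⁿ-closed k d = □ⁿ-⇒E* k (□ⁿ-coreflect-≤′ (≤⇒≤′ z≤n) (⇒I* d))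

-- Implications quantify over all later levels because the □-rule re-uses the
-- open assumptions one level up.
infix 3 _⊩_

_⊩_ : ℕ → Formula → Set
k ⊩ atom n = [] ⊢ □ⁿ k (atom n)
k ⊩ ⊥'     = ⊥
k ⊩ A ∧' B = k ⊩ A × k ⊩ B
k ⊩ A ∨' B = k ⊩ A ⊎ k ⊩ B
k ⊩ A ⇒ B  = ([] ⊢ □ⁿ k (A ⇒ B)) × (∀ {j} → k ≤ j → j ⊩ A → j ⊩ B)
k ⊩ □ A    = ([] ⊢ □ⁿ k (□ A)) × suc k ⊩ A

⊩-mono : ∀ A {k j} → k ≤ j → k ⊩ A → j ⊩ A
⊩-mono (atom n) k≤j d       = □ⁿ-coreflect-≤′ (≤⇒≤′ k≤j) d
⊩-mono ⊥'       k≤j ()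
⊩-mono (A ∧' B) k≤j (a , b) = ⊩-mono A k≤j a , ⊩-mono B k≤j b
⊩-mono (A ∨' B) k≤j s       = Sum.map (⊩-mono A k≤j) (⊩-mono B k≤j) s
⊩-mono (A ⇒ B)  k≤j (d , f) = □ⁿ-coreflect-≤′ (≤⇒≤′ k≤j) d , λ j≤i → f (≤-trans k≤j j≤i)
⊩-mono (□ A)    k≤j (d , a) = □ⁿ-coreflect-≤′ (≤⇒≤′ k≤j) d , ⊩-mono A (s≤s k≤j) a

reify : ∀ {k} A → k ⊩ A → [] ⊢ □ⁿ k A
reify     (atom n) d        = d
reify     ⊥'       ()
reify {k} (A ∧' B) (a , b)  = □ⁿ-closed k (∧I (ax (here refl)) (ax (there (here refl))))
                                (reify A a ∷ reify B b ∷ [])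
reify {k} (A ∨' B) (inj₁ a) = □ⁿ-closed k (∨I₁ (ax (here refl))) (reify A a ∷ [])
reify {k} (A ∨' B) (inj₂ b) = □ⁿ-closed k (∨I₂ (ax (here refl))) (reify B b ∷ [])
reify     (A ⇒ B)  (d , _)  = d
reify     (□ A)    (d , _)  = d

reify-All : ∀ {k Γ} → All (k ⊩_) Γ → All (λ A → [] ⊢ □ⁿ k A) Γ
reify-All = All.map (λ {A} → reify A)

⊩-mono-All : ∀ {k j Γ} → k ≤ j → All (k ⊩_) Γ → All (j ⊩_) Γ
⊩-mono-All k≤j = All.map (λ {A} → ⊩-mono A k≤j)

mutual
  sound : ∀ {k Γ C} → Γ ⊢ C → All (k ⊩_) Γ → k ⊩ C
  sound (ax A∈Γ)   ρ = All.lookup ρ A∈Γ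
  sound (∧I d e)   ρ = sound d ρ , sound e ρ
  sound (∧E₁ d)    ρ = proj₁ (sound d ρ)
  sound (∧E₂ d)    ρ = proj₂ (sound d ρ)
  sound (∨I₁ d)    ρ = inj₁ (sound d ρ)
  sound (∨I₂ d)    ρ = inj₂ (sound d ρ)
  sound (∨E d e f) ρ = [ (λ a → sound e (a ∷ ρ)) , (λ b → sound f (b ∷ ρ)) ] (sound d ρ)
  sound (⇒I d)     ρ = □ⁿ-closed _ (⇒I d) (reify-All ρ) ,
                       λ k≤j a → sound d (a ∷ ⊩-mono-All k≤j ρ)
  sound (⇒E d e)   ρ = proj₂ (sound d ρ) ≤-refl (sound e ρ)
  sound (⊥E d)     ρ = ⊥-elim (sound d ρ)
  sound (□I As bs d) ρ = □ⁿ-closed _ (□I As bs d) (reify-All ρ) ,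
                         sound d (++⁺ (sound-Boxes bs ρ) (⊩-mono-All (n≤1+n _) ρ))

  sound-Boxes : ∀ {k Γ As} → Boxes Γ As → All (k ⊩_) Γ → All (suc k ⊩_) As
  sound-Boxes []       ρ = []
  sound-Boxes (d ∷ bs) ρ = proj₂ (sound d ρ) ∷ sound-Boxes bs ρ

corollary35 : (A B : Formula) → IEL⁻⊢ (□ (A ∨' B)) → IEL⁻⊢ (□ A) ⊎ IEL⁻⊢ (□ B)
corollary35 A B d = Sum.map (reify A) (reify B) (proj₂ (sound {k = 0} d []))
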